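{- Let $\mathcal{C}$ be a neural code on $n$ neurons and let $\mathcal{D}=\{c\setminus\{n\}\mid c\in\mathcal{C}\}$ be the code on $n-1$ neurons obtained by deleting the $n$-th neuron. Then $\mathrm{CF}(\mathcal{J}_\mathcal{D})=\{\alpha\in\mathrm{CF}(\mathcal{J}_\mathcal{C})\mid x_n\nmid\alpha \text{ and } (1-x_n)\nmid\alpha\}$.
   Context: A neural code on $n$ neurons is a collection of subsets of $[n]$. A pseudo-monomial in $\mathbb{F}_2[x_1,\dots,x_n]$ is a polynomial of the form $\prod_{i\in\sigma}x_i\prod_{j\in\tau}(1-x_j)$ with $\sigma,\tau\subseteq[n]$, $\sigma\cap\tau=\emptyset$. For an ideal $J$, a pseudo-monomial $f\in J$ is minimal if there is no pseudo-monomial $g\in J$ with $\deg g<\deg f$ and $f=hg$ for some polynomial $h$; the canonical form $\mathrm{CF}(J)$ is the set of all minimal pseudo-monomials of $J$. For $v\subseteq[n]$ let $\rho_v=\prod_{i\in v}x_i\prod_{j\in[n]\setminus v}(1-x_j)$. The neural ideal of a code $\mathcal{C}$ on $n$ neurons is $\mathcal{J}_\mathcal{C}=\langle \rho_v\mid v\subseteq[n],\ v\notin\mathcal{C}\rangle\subseteq\mathbb{F}_2[x_1,\dots,x_n]$. For $\mathcal{D}$ on $n-1$ neurons these are taken in $\mathbb{F}_2[x_1,\dots,x_{n-1}]\subseteq\mathbb{F}_2[x_1,\dots,x_n]$. -}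

module Defs where

open import Data.Nat as ℕ using (ℕ; zero; suc; _<_)
open import Data.Bool using (Bool; true; false; if_then_else_)
open import Data.Fin using (Fin; _≟_)
open import Data.Fin.Subset as S using (Subset; ∁; ∣_∣)
open import Data.Vec as V using (Vec; _∷ʳ_)
open import Data.Vec.Properties using (≡-dec)
open import Data.List as L using (List; []; _∷_; _++_)
open import Data.List.Relation.Unary.All using (All)
open import Data.List.Relation.Unary.Any using (Any)
open import Data.Product using (Σ; _×_; _,_)
open import Relation.Nullary using (¬_; does)
open import Relation.Binary.PropositionalEquality using (_≡_)

-- Polynomials in F₂[x₁,…,xₙ]
-- A monomial is an exponent vector; a polynomial is a finite list of
-- monomials, read as their sum with coefficients in F₂ (so a monomial
-- occurring an even number of times cancels).

Mono : ℕ → Set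
Mono n = Vec ℕ n

Poly : ℕ → Set
Poly n = List (Mono n)

count : ∀ {n} → Mono n → Poly n → ℕ
count m []      = zero
count m (a ∷ p) = if does (≡-dec ℕ._≟_ m a) then suc (count m p) else count m p

parity : ℕ → Bool
parity zero          = false
parity (suc zero)    = true
parity (suc (suc k)) = parity k

coeff : ∀ {n} → Poly n → Mono n → Bool
coeff p m = parity (count m p)

infix 4 _≈_
_≈_ : ∀ {n} → Poly n → Poly n → Set
p ≈ q = ∀ m → coeff p m ≡ coeff q m

infixl 6 _⊕_
infixl 7 _⊗_

_⊕_ : ∀ {n} → Poly n → Poly n → Poly n
p ⊕ q = p ++ q

_⊗_ : ∀ {n} → Poly n → Poly n → Poly n
p ⊗ q = L.concatMap (λ a → L.map (λ b → V.zipWith ℕ._+_ a b) q) p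

one : ∀ {n} → Poly n
one {n} = V.replicate n 0 ∷ []

var : ∀ {n} → Fin n → Poly n
var {n} i = V.tabulate (λ j → if does (i ≟ j) then 1 else 0) ∷ []

-- 1 - x_i  (= 1 + x_i in characteristic 2)
oneMinus : ∀ {n} → Fin n → Poly n
oneMinus i = one ⊕ var i

infix 4 _∣_
_∣_ : ∀ {n} → Poly n → Poly n → Set
g ∣ f = Σ (Poly _) λ h → f ≈ h ⊗ g

factor : ∀ {n} → Subset n → Subset n → Fin n → Poly n
factor σ τ i =
  if V.lookup σ i then var i else (if V.lookup τ i then oneMinus i else one)

pm : ∀ {n} → Subset n → Subset n → Poly n
pm {n} σ τ = L.foldr _⊗_ one (L.map (factor σ τ) (L.allFin n))

Disjoint : ∀ {n} → Subset n → Subset n → Set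
Disjoint σ τ = ∀ i → i S.∈ σ → i S.∉ τ

deg : ∀ {n} → Subset n → Subset n → ℕ
deg σ τ = ∣ σ ∣ ℕ.+ ∣ τ ∣

IsPM : ∀ {n} → Poly n → Set
IsPM {n} f = Σ (Subset n) λ σ → Σ (Subset n) λ τ → Disjoint σ τ × f ≈ pm σ τ

-- f ∈ CF(J): f is a minimal pseudo-monomial of the ideal J
-- (J given as a membership predicate on polynomials)
InCF : ∀ {n} → (Poly n → Set) → Poly n → Set
InCF {n} J f =
  Σ (Subset n) λ σ → Σ (Subset n) λ τ →
    Disjoint σ τ × f ≈ pm σ τ × J f ×
    (∀ σ' τ' → Disjoint σ' τ' → J (pm σ' τ') → deg σ' τ' < deg σ τ →
       ¬ (pm σ' τ' ∣ f))

Code : ℕ → Set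
Code n = List (Subset n)

infix 4 _∈C_ _∉C_
_∈C_ : ∀ {n} → Subset n → Code n → Set
v ∈C C = Any (v ≡_) C

_∉C_ : ∀ {n} → Subset n → Code n → Set
v ∉C C = ¬ (v ∈C C)

ρ : ∀ {n} → Subset n → Poly n
ρ v = pm v (∁ v)

-- membership in J_C = ⟨ ρ_v | v ∉ C ⟩ : f is an F₂[x]-combination
-- Σ h_k ρ_{v_k} with every v_k ∉ C
NeuralIdeal : ∀ {n} → Code n → Poly n → Set
NeuralIdeal {n} C f =
  Σ (List (Poly n × Subset n)) λ gs →
    All (λ { (h , v) → v ∉C C }) gs ×
    f ≈ L.foldr _⊕_ [] (L.map (λ { (h , v) → h ⊗ ρ v }) gs)

deleteLast : ∀ {m} → Code (suc m) → Code m
deleteLast C = L.map V.init C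

ι : ∀ {m} → Poly m → Poly (suc m)
ι p = L.map (λ e → e ∷ʳ 0) p

-- Evaluation at the points of {0,1}ⁿ is a ring homomorphism F₂[x₁,…,xₙ] → F₂, under which the
-- pseudo-monomial with data (σ, τ) becomes the indicator function of the box σ ⊆ p ⊆ ∁ τ.
-- Hence a pseudo-monomial lies in J_C iff it vanishes on C (one direction by evaluation, the
-- other by writing it as the sum of the ρ_v over its box), and one pseudo-monomial divides
-- another iff their boxes are nested. A minimal pseudo-monomial of J_C divisible by neither x_n
-- nor 1 - x_n is one not involving x_n. For such pseudo-monomials, vanishing on C is vanishing on
-- D, the degree does not change under restriction, and every pseudo-monomial divisor again avoids
-- x_n; so minimality passes between J_C and J_D in both directions.

module Submission where

open import Defs
open import Algebra.Bundles using (CommutativeMonoid)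
open import Algebra.Structures using (IsCommutativeMonoid)
import Algebra.Properties.CommutativeSemigroup as CommSemigroupProperties
open import Data.Bool using (Bool; T; true; false; not; _∧_; _∨_; _xor_; if_then_else_)
open import Data.Bool.ListAction using (all)
open import Data.Bool.Properties
  using ( xor-assoc; xor-comm; xor-same; xor-identityʳ; not-distribʳ-xor; not-involutive; ¬-not; T-≡; T-∧
        ; ∨-identityʳ; ∧-identityʳ; ∧-idem; ∧-zeroʳ; ∧-distribˡ-xor; ∧-distribʳ-xor; ∧-commutativeMonoid)
open import Data.Empty using (⊥-elim)
open import Data.Fin using (Fin; zero; suc; _≟_; fromℕ; inject₁)
open import Data.Fin.Subset using (Subset; _∈_; _∉_; _⊆_; _∪_; _─_; ⁅_⁆; ∁; ∣_∣) renaming (⊥ to ∅)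
open import Data.Fin.Subset.Properties
  using ( _∈?_; ⊆-refl; ⊆-trans; ⊆-antisym; ⊥⊆; ∉⊥; x∈⁅x⁆; x∈⁅y⁆⇒x≡y; x≢y⇒x∉⁅y⁆
        ; x∉p⇒x∈∁p; x∈∁p⇒x∉p; x∉∁p⇒x∈p; x∈p⇒x∉∁p; p⊆p∪q; x∈p∪q⁺; x∈p∪q⁻)
open import Data.List as L using (List; []; _∷_; _++_; length)
open import Data.List.Properties
  using (++-assoc; ++-identityʳ; map-++; map-cong; map-∘; map-id; concatMap-++; foldr-++; map-tabulate; tabulate-cong)
open import Data.List.Membership.Propositional using () renaming (_∈_ to _∈ₗ_)
open import Data.List.Membership.Propositional.Properties using (∈-∃++; ∈-allFin; ∈-map⁺; ∈-map⁻)
open import Data.List.Relation.Unary.All as All using (All; []; _∷_)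
open import Data.List.Relation.Unary.All.Properties using (all⁺; all⁻; ++⁺)
open import Data.List.Relation.Unary.AllPairs using ([]; _∷_)
open import Data.List.Relation.Unary.Any using (here; there)
open import Data.List.Relation.Unary.Unique.Propositional using (Unique)
open import Data.List.Relation.Unary.Unique.Propositional.Properties using (allFin⁺)
open import Data.Nat as ℕ using (ℕ; zero; suc; _<_; _≤_; s≤s)
open import Data.Nat.Properties using (+-comm; +-assoc; +-identityˡ; +-identityʳ; ≤-refl; n<1+n; <⇒≤; <-≤-trans)
open import Data.Product as Product using (Σ; _×_; _,_; proj₁; proj₂)
open import Data.Sum as Sum using (_⊎_; inj₁; inj₂; [_,_]′)
import Data.Vec as V
open import Data.Vec using (Vec; _∷ʳ_; here; there)
open import Data.Vec.Properties
  using (≡-dec; lookup-zipWith; []=⇒lookup; lookup⇒[]=; zipWith-assoc; zipWith-identityˡ; zipWith-identityʳ)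
open import Function using (_∘_; id; case_of_)
open import Function.Bundles using (_⇔_; mk⇔; Equivalence)
open import Relation.Binary.Bundles using (Setoid)
open import Relation.Binary.Structures using (IsEquivalence)
import Relation.Binary.Reasoning.Setoid
open import Relation.Binary.PropositionalEquality
  using (_≡_; _≢_; refl; sym; trans; cong; cong₂; subst; subst₂; module ≡-Reasoning)
open import Relation.Nullary using (¬_; yes; no; does; contradiction)
open import Relation.Nullary.Decidable using (dec-true)

private
  variable
    n k : ℕ

-- Arithmetic in F₂[x₁,…,xₙ]

-- Wrapping the coefficientwise equality in a record lets Agda recover the
-- two polynomials from a proof of their equality.
infix 4 _≋_
record _≋_ (p q : Poly n) : Set where
  constructor coeffwise
  field coeff-≡ : p ≈ q
open _≋_ public

≋-isEquivalence : IsEquivalence (_≋_ {n})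
≋-isEquivalence = record
  { refl  = coeffwise λ _ → refl
  ; sym   = λ (coeffwise e) → coeffwise λ m → sym (e m)
  ; trans = λ (coeffwise e) (coeffwise e′) → coeffwise λ m → trans (e m) (e′ m)
  }

≋-setoid : ℕ → Setoid _ _
≋-setoid n = record { isEquivalence = ≋-isEquivalence {n} }

open module ≋-Properties {n} = Setoid (≋-setoid n) public
  using () renaming (refl to ≋-refl; sym to ≋-sym; trans to ≋-trans; reflexive to ≡⇒≋)

module ≋-Reasoning {n} = Relation.Binary.Reasoning.Setoid (≋-setoid n)

parity-suc : ∀ a → parity (suc a) ≡ not (parity a)
parity-suc zero          = refl
parity-suc (suc zero)    = refl
parity-suc (suc (suc a)) = parity-suc a

parity-+ : ∀ a b → parity (a ℕ.+ b) ≡ parity a xor parity b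
parity-+ zero          b = refl
parity-+ (suc zero)    b = parity-suc b
parity-+ (suc (suc a)) b = parity-+ a b

count-++ : ∀ (m : Mono n) p q → count m (p ++ q) ≡ count m p ℕ.+ count m q
count-++ m []      q = refl
count-++ m (a ∷ p) q with does (≡-dec ℕ._≟_ m a)
... | true  = cong suc (count-++ m p q)
... | false = count-++ m p q

coeff-⊕ : ∀ (p q : Poly n) m → coeff (p ⊕ q) m ≡ coeff p m xor coeff q m
coeff-⊕ p q m = trans (cong parity (count-++ m p q)) (parity-+ (count m p) (count m q))

⊕-cong : ∀ {p p′ q q′ : Poly n} → p ≋ p′ → q ≋ q′ → p ⊕ q ≋ p′ ⊕ q′
⊕-cong {p = p} {p′} {q} {q′} (coeffwise e) (coeffwise e′) = coeffwise λ m → begin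
  coeff (p ⊕ q) m          ≡⟨ coeff-⊕ p q m ⟩
  coeff p m xor coeff q m   ≡⟨ cong₂ _xor_ (e m) (e′ m) ⟩
  coeff p′ m xor coeff q′ m ≡⟨ coeff-⊕ p′ q′ m ⟨
  coeff (p′ ⊕ q′) m        ∎
  where open ≡-Reasoning

⊕-comm : ∀ (p q : Poly n) → p ⊕ q ≋ q ⊕ p
⊕-comm p q = coeffwise λ m →
  trans (coeff-⊕ p q m) (trans (xor-comm (coeff p m) (coeff q m)) (sym (coeff-⊕ q p m)))

⊕-self : ∀ (p : Poly n) → p ⊕ p ≋ []
⊕-self p = coeffwise λ m → trans (coeff-⊕ p p m) (xor-same (coeff p m))

⊕-isCommutativeMonoid : IsCommutativeMonoid (_≋_ {n}) _⊕_ []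
⊕-isCommutativeMonoid = record
  { isMonoid = record
    { isSemigroup = record
      { isMagma = record { isEquivalence = ≋-isEquivalence ; ∙-cong = ⊕-cong }
      ; assoc   = λ p q r → ≡⇒≋ (++-assoc p q r)
      }
    ; identity = (λ _ → ≋-refl) , (λ p → ≡⇒≋ (++-identityʳ p))
    }
  ; comm = ⊕-comm
  }

⊕-commutativeMonoid : ℕ → CommutativeMonoid _ _
⊕-commutativeMonoid n = record { isCommutativeMonoid = ⊕-isCommutativeMonoid {n} }

module ⊕-Properties {n} = CommSemigroupProperties
  (CommutativeMonoid.commutativeSemigroup (⊕-commutativeMonoid n))

⊕-cancel : ∀ (x l r : Poly n) → x ⊕ (l ⊕ (x ⊕ r)) ≋ l ⊕ r
⊕-cancel x l r = begin
  x ⊕ (l ⊕ (x ⊕ r)) ≈⟨ x∙yz≈y∙xz x l (x ⊕ r) ⟩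
  l ⊕ (x ⊕ (x ⊕ r)) ≈⟨ ⊕-cong (≋-refl {x = l}) (≡⇒≋ (sym (++-assoc x x r))) ⟩
  l ⊕ ((x ⊕ x) ⊕ r) ≈⟨ ⊕-cong (≋-refl {x = l}) (⊕-cong (⊕-self x) (≋-refl {x = r})) ⟩
  l ⊕ r             ∎
  where open ⊕-Properties
        open ≋-Reasoning

xor≡false⇒≡ : ∀ x y → x xor y ≡ false → x ≡ y
xor≡false⇒≡ false false _ = refl
xor≡false⇒≡ true  true  _ = refl

⊕≋[]⇒≋ : ∀ {p q : Poly n} → p ⊕ q ≋ [] → p ≋ q
⊕≋[]⇒≋ {p = p} {q} (coeffwise e) = coeffwise λ m →
  xor≡false⇒≡ (coeff p m) (coeff q m) (trans (sym (coeff-⊕ p q m)) (e m))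

≋⇒⊕≋[] : ∀ {p q : Poly n} → p ≋ q → p ⊕ q ≋ []
≋⇒⊕≋[] {q = q} p≋q = ≋-trans (⊕-cong p≋q (≋-refl {x = q})) (⊕-self q)

count-∷-self : ∀ (a : Mono n) p → count a (a ∷ p) ≡ suc (count a p)
count-∷-self a p rewrite dec-true (≡-dec ℕ._≟_ a a) refl = refl

count≢0⇒∈ : ∀ (a : Mono n) p → count a p ≢ 0 → a ∈ₗ p
count≢0⇒∈ a []      c≢0 = ⊥-elim (c≢0 refl)
count≢0⇒∈ a (b ∷ p) c≢0 with ≡-dec ℕ._≟_ a b
... | yes a≡b = here a≡b
... | no  _   = there (count≢0⇒∈ a p c≢0)

∷≋[]⇒∈ : ∀ a (p : Poly n) → a ∷ p ≋ [] → a ∈ₗ p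
∷≋[]⇒∈ a p (coeffwise e) = count≢0⇒∈ a p λ c≡0 →
  true≢false (trans (cong parity (trans (sym (cong suc c≡0)) (sym (count-∷-self a p)))) (e a))
  where
  true≢false : true ≢ false
  true≢false ()

length-++-< : ∀ {A : Set} (l r : List A) a → length (l ++ r) < length (l ++ a ∷ r)
length-++-< []      r a = n<1+n (length r)
length-++-< (_ ∷ l) r a = s≤s (length-++-< l r a)

≋[]-ind : (P : Poly n → Set) → P [] →
          (∀ a l r → P (l ++ r) → P (a ∷ l ++ a ∷ r)) →
          ∀ q → q ≋ [] → P q
≋[]-ind P P[] Ppair q = go (length q) q ≤-refl
  where
  go : ∀ k q → length q ≤ k → q ≋ [] → P q
  go _       []      _          _    = P[]
  go (suc k) (a ∷ q) (s≤s |q|≤k) q≋[] with ∈-∃++ (∷≋[]⇒∈ a q q≋[])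
  ... | l , r , refl = Ppair a l r (go k (l ++ r)
          (<⇒≤ (<-≤-trans (length-++-< l r a) |q|≤k))
          (≋-trans (≋-sym (⊕-cancel (a ∷ []) l r)) q≋[]))

Additive : (Poly n → Poly k) → Set
Additive Φ = ∀ p q → Φ (p ⊕ q) ≋ Φ p ⊕ Φ q

additive-≋[] : ∀ (Φ : Poly n → Poly k) → Additive Φ → ∀ q → q ≋ [] → Φ q ≋ []
additive-≋[] Φ hom = ≋[]-ind (λ q → Φ q ≋ []) (≋-trans (hom [] []) (⊕-self (Φ []))) pair
  where
  pair : ∀ a l r → Φ (l ++ r) ≋ [] → Φ (a ∷ l ++ a ∷ r) ≋ []
  pair a l r Φ[l++r]≋[] = begin
    Φ (a ∷ l ++ a ∷ r)                       ≈⟨ hom (a ∷ []) (l ++ a ∷ r) ⟩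
    Φ (a ∷ []) ⊕ Φ (l ++ a ∷ r)              ≈⟨ ⊕-cong ≋-refl (≋-trans (hom l (a ∷ r))
                                                  (⊕-cong ≋-refl (hom (a ∷ []) r))) ⟩
    Φ (a ∷ []) ⊕ (Φ l ⊕ (Φ (a ∷ []) ⊕ Φ r))  ≈⟨ ⊕-cancel (Φ (a ∷ [])) (Φ l) (Φ r) ⟩
    Φ l ⊕ Φ r                                ≈⟨ hom l r ⟨
    Φ (l ++ r)                               ≈⟨ Φ[l++r]≋[] ⟩
    []                                       ∎
    where open ≋-Reasoning

additive-cong : ∀ (Φ : Poly n → Poly k) → Additive Φ → ∀ {p q} → p ≋ q → Φ p ≋ Φ q
additive-cong Φ hom {p} {q} p≋q =
  ⊕≋[]⇒≋ (≋-trans (≋-sym (hom p q)) (additive-≋[] Φ hom (p ⊕ q) (≋⇒⊕≋[] p≋q)))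

xor-cancel : ∀ x y z → x xor (y xor (x xor z)) ≡ y xor z
xor-cancel false y z = refl
xor-cancel true  y z = trans (not-distribʳ-xor y (not z)) (cong (y xor_) (not-involutive z))

xor-additive-cong : ∀ (F : Poly n → Bool) → (∀ p q → F (p ⊕ q) ≡ F p xor F q) →
                    ∀ {p q} → p ≋ q → F p ≡ F q
xor-additive-cong F hom {p} {q} p≋q =
  xor≡false⇒≡ (F p) (F q) (trans (sym (hom p q)) (vanish (p ⊕ q) (≋⇒⊕≋[] p≋q)))
  where
  vanish : ∀ q → q ≋ [] → F q ≡ false
  vanish = ≋[]-ind (λ q → F q ≡ false) (trans (hom [] []) (xor-same (F []))) pair
    where
    pair : ∀ a l r → F (l ++ r) ≡ false → F (a ∷ l ++ a ∷ r) ≡ false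
    pair a l r F[l++r]≡false = begin
      F (a ∷ l ++ a ∷ r)                             ≡⟨ hom (a ∷ []) (l ++ a ∷ r) ⟩
      F (a ∷ []) xor F (l ++ a ∷ r)                  ≡⟨ cong (F (a ∷ []) xor_) (trans (hom l (a ∷ r))
                                                          (cong (F l xor_) (hom (a ∷ []) r))) ⟩
      F (a ∷ []) xor (F l xor (F (a ∷ []) xor F r))  ≡⟨ xor-cancel (F (a ∷ [])) (F l) (F r) ⟩
      F l xor F r                                    ≡⟨ hom l r ⟨
      F (l ++ r)                                     ≡⟨ F[l++r]≡false ⟩
      false                                          ∎
      where open ≡-Reasoning

infixl 6 _+ᵉ_
_+ᵉ_ : Mono n → Mono n → Mono n
_+ᵉ_ = V.zipWith ℕ._+_

+ᵉ-comm : ∀ (a b : Mono n) → a +ᵉ b ≡ b +ᵉ a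
+ᵉ-comm V.[]      V.[]      = refl
+ᵉ-comm (x V.∷ a) (y V.∷ b) = cong₂ V._∷_ (+-comm x y) (+ᵉ-comm a b)

+ᵉ-assoc : ∀ (a b c : Mono n) → (a +ᵉ b) +ᵉ c ≡ a +ᵉ (b +ᵉ c)
+ᵉ-assoc = zipWith-assoc +-assoc

+ᵉ-identityˡ : ∀ (a : Mono n) → V.replicate n 0 +ᵉ a ≡ a
+ᵉ-identityˡ = zipWith-identityˡ +-identityˡ

+ᵉ-identityʳ : ∀ (a : Mono n) → a +ᵉ V.replicate n 0 ≡ a
+ᵉ-identityʳ = zipWith-identityʳ +-identityʳ

map-additive : ∀ (g : Mono n → Mono k) → Additive (L.map g)
map-additive g p q = ≡⇒≋ (map-++ g p q)

⊗-distribʳ-⊕ : ∀ (p q r : Poly n) → (p ⊕ q) ⊗ r ≡ p ⊗ r ⊕ q ⊗ r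
⊗-distribʳ-⊕ p q r = concatMap-++ (λ a → L.map (a +ᵉ_) r) p q

⊗-zeroʳ : ∀ (p : Poly n) → p ⊗ [] ≡ []
⊗-zeroʳ []      = refl
⊗-zeroʳ (_ ∷ p) = ⊗-zeroʳ p

⊕-interchange : ∀ (a b c d : Poly n) → (a ⊕ b) ⊕ (c ⊕ d) ≋ (a ⊕ c) ⊕ (b ⊕ d)
⊕-interchange = ⊕-Properties.interchange

⊗-distribˡ-⊕ : ∀ (p q r : Poly n) → p ⊗ (q ⊕ r) ≋ p ⊗ q ⊕ p ⊗ r
⊗-distribˡ-⊕ []      q r = ≋-refl
⊗-distribˡ-⊕ (a ∷ p) q r = begin
  L.map (a +ᵉ_) (q ⊕ r) ⊕ p ⊗ (q ⊕ r)
    ≈⟨ ⊕-cong (≡⇒≋ (map-++ (a +ᵉ_) q r)) (⊗-distribˡ-⊕ p q r) ⟩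
  (L.map (a +ᵉ_) q ⊕ L.map (a +ᵉ_) r) ⊕ (p ⊗ q ⊕ p ⊗ r)
    ≈⟨ ⊕-interchange (L.map (a +ᵉ_) q) (L.map (a +ᵉ_) r) (p ⊗ q) (p ⊗ r) ⟩
  (L.map (a +ᵉ_) q ⊕ p ⊗ q) ⊕ (L.map (a +ᵉ_) r ⊕ p ⊗ r) ∎
  where open ≋-Reasoning

⊗-congˡ : ∀ {p p′ : Poly n} r → p ≋ p′ → p ⊗ r ≋ p′ ⊗ r
⊗-congˡ r = additive-cong (_⊗ r) λ p q → ≡⇒≋ (⊗-distribʳ-⊕ p q r)

⊗-congʳ : ∀ (p : Poly n) {q q′} → q ≋ q′ → p ⊗ q ≋ p ⊗ q′
⊗-congʳ p = additive-cong (p ⊗_) (⊗-distribˡ-⊕ p)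

⊗-cong : ∀ {p p′ q q′ : Poly n} → p ≋ p′ → q ≋ q′ → p ⊗ q ≋ p′ ⊗ q′
⊗-cong {p′ = p′} {q} p≋p′ q≋q′ = ≋-trans (⊗-congˡ q p≋p′) (⊗-congʳ p′ q≋q′)

⊗-identityˡ : ∀ (p : Poly n) → one ⊗ p ≡ p
⊗-identityˡ p = trans (++-identityʳ _) (trans (map-cong +ᵉ-identityˡ p) (map-id p))

⊗-identityʳ : ∀ (p : Poly n) → p ⊗ one ≡ p
⊗-identityʳ []      = refl
⊗-identityʳ (a ∷ p) = cong₂ _∷_ (+ᵉ-identityʳ a) (⊗-identityʳ p)

map-+ᵉ-⊗ : ∀ a (q r : Poly n) → L.map (a +ᵉ_) q ⊗ r ≡ L.map (a +ᵉ_) (q ⊗ r)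
map-+ᵉ-⊗ a []      r = refl
map-+ᵉ-⊗ a (b ∷ q) r = begin
  L.map ((a +ᵉ b) +ᵉ_) r ⊕ L.map (a +ᵉ_) q ⊗ r
    ≡⟨ cong₂ _⊕_ (trans (map-cong (+ᵉ-assoc a b) r) (map-∘ r)) (map-+ᵉ-⊗ a q r) ⟩
  L.map (a +ᵉ_) (L.map (b +ᵉ_) r) ⊕ L.map (a +ᵉ_) (q ⊗ r)
    ≡⟨ map-++ (a +ᵉ_) (L.map (b +ᵉ_) r) (q ⊗ r) ⟨
  L.map (a +ᵉ_) (L.map (b +ᵉ_) r ⊕ q ⊗ r) ∎
  where open ≡-Reasoning

⊗-assoc : ∀ (p q r : Poly n) → (p ⊗ q) ⊗ r ≡ p ⊗ (q ⊗ r)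
⊗-assoc []      q r = refl
⊗-assoc (a ∷ p) q r =
  trans (⊗-distribʳ-⊕ (L.map (a +ᵉ_) q) (p ⊗ q) r) (cong₂ _⊕_ (map-+ᵉ-⊗ a q r) (⊗-assoc p q r))

⊗-singletonʳ : ∀ (q : Poly n) a → q ⊗ (a ∷ []) ≡ L.map (a +ᵉ_) q
⊗-singletonʳ []      a = refl
⊗-singletonʳ (b ∷ q) a = cong₂ _∷_ (+ᵉ-comm b a) (⊗-singletonʳ q a)

⊗-comm : ∀ (p q : Poly n) → p ⊗ q ≋ q ⊗ p
⊗-comm []      q = ≡⇒≋ (sym (⊗-zeroʳ q))
⊗-comm (a ∷ p) q = begin
  L.map (a +ᵉ_) q ⊕ p ⊗ q  ≈⟨ ⊕-cong (≡⇒≋ (sym (⊗-singletonʳ q a))) (⊗-comm p q) ⟩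
  q ⊗ (a ∷ []) ⊕ q ⊗ p     ≈⟨ ⊗-distribˡ-⊕ q (a ∷ []) p ⟨
  q ⊗ (a ∷ p)              ∎
  where open ≋-Reasoning

⊗-isCommutativeMonoid : IsCommutativeMonoid (_≋_ {n}) _⊗_ one
⊗-isCommutativeMonoid = record
  { isMonoid = record
    { isSemigroup = record
      { isMagma = record { isEquivalence = ≋-isEquivalence ; ∙-cong = ⊗-cong }
      ; assoc   = λ p q r → ≡⇒≋ (⊗-assoc p q r)
      }
    ; identity = (λ p → ≡⇒≋ (⊗-identityˡ p)) , (λ p → ≡⇒≋ (⊗-identityʳ p))
    }
  ; comm = ⊗-comm
  }

⊗-commutativeMonoid : ℕ → CommutativeMonoid _ _
⊗-commutativeMonoid n = record { isCommutativeMonoid = ⊗-isCommutativeMonoid {n} }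

⊗-interchange : ∀ (a b c d : Poly n) → (a ⊗ b) ⊗ (c ⊗ d) ≋ (a ⊗ c) ⊗ (b ⊗ d)
⊗-interchange = CommSemigroupProperties.interchange
  (CommutativeMonoid.commutativeSemigroup (⊗-commutativeMonoid _))

-- Evaluation at the points of {0,1}ⁿ

infixr 8 _^ᵇ_
_^ᵇ_ : Bool → ℕ → Bool
b ^ᵇ zero  = true
b ^ᵇ suc _ = b

^ᵇ-+ : ∀ b e f → b ^ᵇ (e ℕ.+ f) ≡ b ^ᵇ e ∧ b ^ᵇ f
^ᵇ-+ b zero    f       = refl
^ᵇ-+ b (suc e) zero    = sym (∧-identityʳ b)
^ᵇ-+ b (suc e) (suc f) = sym (∧-idem b)

-- A point of {0,1}ⁿ is given as the set of its coordinates equal to 1.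
evalMono : Subset n → Mono n → Bool
evalMono V.[]      V.[]      = true
evalMono (b V.∷ p) (e V.∷ a) = b ^ᵇ e ∧ evalMono p a

eval : Subset n → Poly n → Bool
eval p []      = false
eval p (a ∷ f) = evalMono p a xor eval p f

eval-⊕ : ∀ (p : Subset n) f g → eval p (f ⊕ g) ≡ eval p f xor eval p g
eval-⊕ p []      g = refl
eval-⊕ p (a ∷ f) g = trans (cong (evalMono p a xor_) (eval-⊕ p f g)) (sym (xor-assoc (evalMono p a) _ _))

eval-cong : ∀ (p : Subset n) {f g} → f ≋ g → eval p f ≡ eval p g
eval-cong p = xor-additive-cong (eval p) (eval-⊕ p)

evalMono-+ᵉ : ∀ (p : Subset n) a b → evalMono p (a +ᵉ b) ≡ evalMono p a ∧ evalMono p b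
evalMono-+ᵉ V.[]      V.[]      V.[]      = refl
evalMono-+ᵉ (x V.∷ p) (e V.∷ a) (f V.∷ b) = begin
  x ^ᵇ (e ℕ.+ f) ∧ evalMono p (a +ᵉ b)                 ≡⟨ cong₂ _∧_ (^ᵇ-+ x e f) (evalMono-+ᵉ p a b) ⟩
  (x ^ᵇ e ∧ x ^ᵇ f) ∧ (evalMono p a ∧ evalMono p b)     ≡⟨ ∧-interchange (x ^ᵇ e) (x ^ᵇ f) _ _ ⟩
  (x ^ᵇ e ∧ evalMono p a) ∧ (x ^ᵇ f ∧ evalMono p b)     ∎
  where open ≡-Reasoning
        ∧-interchange = CommSemigroupProperties.interchange
          (CommutativeMonoid.commutativeSemigroup ∧-commutativeMonoid)

eval-map-+ᵉ : ∀ (p : Subset n) a g → eval p (L.map (a +ᵉ_) g) ≡ evalMono p a ∧ eval p g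
eval-map-+ᵉ p a []      = sym (∧-zeroʳ (evalMono p a))
eval-map-+ᵉ p a (b ∷ g) =
  trans (cong₂ _xor_ (evalMono-+ᵉ p a b) (eval-map-+ᵉ p a g)) (sym (∧-distribˡ-xor (evalMono p a) _ _))

eval-⊗ : ∀ (p : Subset n) f g → eval p (f ⊗ g) ≡ eval p f ∧ eval p g
eval-⊗ p []      g = refl
eval-⊗ p (a ∷ f) g = begin
  eval p (L.map (a +ᵉ_) g ⊕ f ⊗ g)                     ≡⟨ eval-⊕ p (L.map (a +ᵉ_) g) (f ⊗ g) ⟩
  eval p (L.map (a +ᵉ_) g) xor eval p (f ⊗ g)          ≡⟨ cong₂ _xor_ (eval-map-+ᵉ p a g) (eval-⊗ p f g) ⟩
  (evalMono p a ∧ eval p g) xor (eval p f ∧ eval p g)  ≡⟨ ∧-distribʳ-xor (eval p g) (evalMono p a) (eval p f) ⟨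
  (evalMono p a xor eval p f) ∧ eval p g               ∎
  where open ≡-Reasoning

evalMono-0 : ∀ (p : Subset n) → evalMono p (V.replicate n 0) ≡ true
evalMono-0 V.[]      = refl
evalMono-0 (_ V.∷ p) = evalMono-0 p

eval-one : ∀ (p : Subset n) → eval p one ≡ true
eval-one p = cong (_xor false) (evalMono-0 p)

eval-var : ∀ (p : Subset n) i → eval p (var i) ≡ V.lookup p i
eval-var p i = trans (xor-identityʳ _) (evalMono-var p i)
  where
  tabulate-const : ∀ {n} x → V.tabulate {n = n} (λ _ → x) ≡ V.replicate n x
  tabulate-const {zero}  x = refl
  tabulate-const {suc n} x = cong (x V.∷_) (tabulate-const x)

  evalMono-var : ∀ {n} (p : Subset n) i →
                 evalMono p (V.tabulate λ j → if does (i ≟ j) then 1 else 0) ≡ V.lookup p i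
  evalMono-var (b V.∷ p) zero    = trans (cong (b ∧_) (trans (cong (evalMono p) (tabulate-const 0)) (evalMono-0 p)))
                                         (∧-identityʳ b)
  evalMono-var (b V.∷ p) (suc i) = evalMono-var p i

eval-oneMinus : ∀ (p : Subset n) i → eval p (oneMinus i) ≡ not (V.lookup p i)
eval-oneMinus p i = trans (eval-⊕ p one (var i)) (cong₂ _xor_ (eval-one p) (eval-var p i))

-- Products and pseudo-monomials

prod : List (Poly n) → Poly n
prod = L.foldr _⊗_ one

module _ {A : Set} where

  prod-cong : ∀ (F G : A → Poly n) {js} → All (λ j → F j ≋ G j) js →
              prod (L.map F js) ≋ prod (L.map G js)
  prod-cong F G []             = ≋-refl
  prod-cong F G (Fj≋Gj ∷ F≋G) = ⊗-cong Fj≋Gj (prod-cong F G F≋G)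

  prod-⊗ : ∀ (F G H : A → Poly n) js → (∀ j → F j ≋ G j ⊗ H j) →
           prod (L.map F js) ≋ prod (L.map G js) ⊗ prod (L.map H js)
  prod-⊗ F G H []       _ = ≡⇒≋ (sym (⊗-identityˡ one))
  prod-⊗ F G H (j ∷ js) F≋GH =
    ≋-trans (⊗-cong (F≋GH j) (prod-⊗ F G H js F≋GH)) (⊗-interchange (G j) (H j) _ _)

  private
    agree-off : ∀ (F G : A → Poly n) {i js} → (∀ j → j ≢ i → F j ≋ G j) →
                All (i ≢_) js → All (λ j → F j ≋ G j) js
    agree-off F G F≋G = All.map λ i≢j → F≋G _ (i≢j ∘ sym)

  prod-linear-at : ∀ (F G H : A → Poly n) i {js} → Unique js → i ∈ₗ js →
                   (∀ j → j ≢ i → F j ≋ G j) → (∀ j → j ≢ i → F j ≋ H j) → F i ≋ G i ⊕ H i →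
                   prod (L.map F js) ≋ prod (L.map G js) ⊕ prod (L.map H js)
  prod-linear-at F G H i {j ∷ js} (i∉js ∷ _) (here refl) F≋G F≋H Fi≋Gi⊕Hi = begin
    F j ⊗ prod (L.map F js)
      ≈⟨ ⊗-cong Fi≋Gi⊕Hi ≋-refl ⟩
    (G j ⊕ H j) ⊗ prod (L.map F js)
      ≡⟨ ⊗-distribʳ-⊕ (G j) (H j) _ ⟩
    G j ⊗ prod (L.map F js) ⊕ H j ⊗ prod (L.map F js)
      ≈⟨ ⊕-cong (⊗-congʳ (G j) (prod-cong F G (agree-off F G F≋G i∉js)))
                (⊗-congʳ (H j) (prod-cong F H (agree-off F H F≋H i∉js))) ⟩
    G j ⊗ prod (L.map G js) ⊕ H j ⊗ prod (L.map H js) ∎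
    where open ≋-Reasoning
  prod-linear-at F G H i {j ∷ js} (j∉js ∷ js!) (there i∈js) F≋G F≋H Fi≋Gi⊕Hi = begin
    F j ⊗ prod (L.map F js)
      ≈⟨ ⊗-congʳ (F j) (prod-linear-at F G H i js! i∈js F≋G F≋H Fi≋Gi⊕Hi) ⟩
    F j ⊗ (prod (L.map G js) ⊕ prod (L.map H js))
      ≈⟨ ⊗-distribˡ-⊕ (F j) _ _ ⟩
    F j ⊗ prod (L.map G js) ⊕ F j ⊗ prod (L.map H js)
      ≈⟨ ⊕-cong (⊗-congˡ _ (F≋G j j≢i)) (⊗-congˡ _ (F≋H j j≢i)) ⟩
    G j ⊗ prod (L.map G js) ⊕ H j ⊗ prod (L.map H js) ∎
    where open ≋-Reasoning
          j≢i = All.lookup j∉js i∈js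

  prod-single : ∀ (F : A → Poly n) i {js} → Unique js → i ∈ₗ js → (∀ j → j ≢ i → F j ≋ one) →
                prod (L.map F js) ≋ F i
  prod-single F i {j ∷ js} (i∉js ∷ _) (here refl) F≋one = begin
    F j ⊗ prod (L.map F js)              ≈⟨ ⊗-congʳ (F j) (prod-cong F (λ _ → one) (agree-off F _ F≋one i∉js)) ⟩
    F j ⊗ prod (L.map (λ _ → one) js)    ≡⟨ cong (F j ⊗_) (prod-ones js) ⟩
    F j ⊗ one                            ≡⟨ ⊗-identityʳ (F j) ⟩
    F j                                  ∎
    where open ≋-Reasoning
          prod-ones : ∀ js → prod (L.map (λ (_ : A) → one {n}) js) ≡ one
          prod-ones []       = refl
          prod-ones (_ ∷ js) = trans (⊗-identityˡ _) (prod-ones js)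
  prod-single F i {j ∷ js} (j∉js ∷ js!) (there i∈js) F≋one =
    ≋-trans (⊗-cong (F≋one j (All.lookup j∉js i∈js)) (prod-single F i js! i∈js F≋one))
            (≡⇒≋ (⊗-identityˡ (F i)))

eval-prod : ∀ {A : Set} (p : Subset n) (F : A → Poly n) js →
            eval p (prod (L.map F js)) ≡ all (eval p ∘ F) js
eval-prod p F []       = eval-one p
eval-prod p F (j ∷ js) = trans (eval-⊗ p (F j) _) (cong (eval p (F j) ∧_) (eval-prod p F js))

private
  variable
    i : Fin n
    p σ τ σ₀ τ₀ : Subset n
    f f′ g g′ : Poly n

T-lookup : T (V.lookup p i) ⇔ i ∈ p
T-lookup {p = p} {i} = mk⇔ (lookup⇒[]= i p ∘ Equivalence.to T-≡) (Equivalence.from T-≡ ∘ []=⇒lookup)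

T-not-lookup : T (not (V.lookup p i)) ⇔ i ∉ p
T-not-lookup {p = p} {i} = mk⇔ (λ t i∈p → subst (T ∘ not) ([]=⇒lookup i∈p) t) from
  where
  from : i ∉ p → T (not (V.lookup p i))
  from i∉p with V.lookup p i in eq
  ... | true  = contradiction (lookup⇒[]= i p eq) i∉p
  ... | false = _

lookup-∉ : i ∉ p → V.lookup p i ≡ false
lookup-∉ {i = i} {p = p} i∉p = ¬-not (i∉p ∘ lookup⇒[]= i p)

Disjoint-sym : Disjoint σ τ → Disjoint τ σ
Disjoint-sym σ#τ i i∈τ i∈σ = σ#τ i i∈σ i∈τ

factorᵇ : Bool → Bool → Fin n → Poly n
factorᵇ s t i = if s then var i else if t then oneMinus i else one

factor-≡ : ∀ (σ τ : Subset n) i {s t} → V.lookup σ i ≡ s → V.lookup τ i ≡ t → factor σ τ i ≡ factorᵇ s t i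
factor-≡ σ τ i = cong₂ (λ s t → factorᵇ s t i)

eval-factor-∈ : i ∈ σ → eval p (factor σ τ i) ≡ V.lookup p i
eval-factor-∈ {i = i} {σ = σ} {p = p} {τ = τ} i∈σ =
  trans (cong (eval p) (factor-≡ σ τ i ([]=⇒lookup i∈σ) refl)) (eval-var p i)

eval-factor-∉∈ : i ∉ σ → i ∈ τ → eval p (factor σ τ i) ≡ not (V.lookup p i)
eval-factor-∉∈ {i = i} {σ = σ} {τ = τ} {p = p} i∉σ i∈τ =
  trans (cong (eval p) (factor-≡ σ τ i (lookup-∉ i∉σ) ([]=⇒lookup i∈τ))) (eval-oneMinus p i)

eval-factor-∉∉ : i ∉ σ → i ∉ τ → eval p (factor σ τ i) ≡ true
eval-factor-∉∉ {i = i} {σ = σ} {τ = τ} {p = p} i∉σ i∉τ =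
  trans (cong (eval p) (factor-≡ σ τ i (lookup-∉ i∉σ) (lookup-∉ i∉τ))) (eval-one p)

eval-pm : ∀ (p σ τ : Subset n) → eval p (pm σ τ) ≡ all (λ i → eval p (factor σ τ i)) (L.allFin n)
eval-pm p σ τ = eval-prod p (factor σ τ) (L.allFin _)

eval-pm⁺ : σ ⊆ p → Disjoint τ p → T (eval p (pm σ τ))
eval-pm⁺ {σ = σ} {p = p} {τ = τ} σ⊆p τ#p =
  subst T (sym (eval-pm p σ τ)) (all⁻ (λ i → eval p (factor σ τ i)) {L.allFin _} (All.tabulate λ {i} _ → holds i))
  where
  holds : ∀ i → T (eval p (factor σ τ i))
  holds i with i ∈? σ | i ∈? τ
  ... | yes i∈σ | _       = subst T (sym (eval-factor-∈ {p = p} {τ = τ} i∈σ)) (Equivalence.from T-lookup (σ⊆p i∈σ))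
  ... | no  i∉σ | yes i∈τ = subst T (sym (eval-factor-∉∈ {p = p} i∉σ i∈τ)) (Equivalence.from T-not-lookup (τ#p i i∈τ))
  ... | no  i∉σ | no  i∉τ = subst T (sym (eval-factor-∉∉ {p = p} i∉σ i∉τ)) _

eval-pm⁻ : Disjoint σ τ → T (eval p (pm σ τ)) → σ ⊆ p × Disjoint τ p
eval-pm⁻ {σ = σ} {τ = τ} {p = p} σ#τ t = σ⊆p , τ#p
  where
  holds : ∀ i → T (eval p (factor σ τ i))
  holds i = All.lookup (all⁺ (λ i → eval p (factor σ τ i)) (L.allFin _) (subst T (eval-pm p σ τ) t)) (∈-allFin i)
  σ⊆p : σ ⊆ p
  σ⊆p {i} i∈σ = Equivalence.to T-lookup (subst T (eval-factor-∈ {p = p} {τ = τ} i∈σ) (holds i))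
  τ#p : Disjoint τ p
  τ#p i i∈τ = Equivalence.to T-not-lookup (subst T (eval-factor-∉∈ {p = p} (Disjoint-sym σ#τ i i∈τ) i∈τ) (holds i))

-- Divisibility between pseudo-monomials

∣-respʳ-≋ : f ≋ f′ → g ∣ f → g ∣ f′
∣-respʳ-≋ (coeffwise f≈f′) (h , f≈hg) = h , λ m → trans (sym (f≈f′ m)) (f≈hg m)

∣-respˡ-≋ : g ≋ g′ → g ∣ f → g′ ∣ f
∣-respˡ-≋ {g = g} {f = f} g≋g′ (h , f≈hg) =
  h , coeff-≡ (≋-trans (coeffwise {p = f} {q = h ⊗ g} f≈hg) (⊗-congʳ h g≋g′))

eval-∣ : ∀ (p : Subset n) → g ∣ f → T (eval p f) → T (eval p g)
eval-∣ {g = g} {f = f} p (h , f≈hg) t =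
  proj₂ (Equivalence.to T-∧ (subst T (trans (eval-cong p (coeffwise {p = f} {q = h ⊗ g} f≈hg)) (eval-⊗ p h g)) t))

lookup-─ : ∀ (p q : Subset n) i → V.lookup (p ─ q) i ≡ V.lookup p i ∧ not (V.lookup q i)
lookup-─ (x V.∷ p) (true  V.∷ q) zero    = sym (∧-zeroʳ x)
lookup-─ (x V.∷ p) (false V.∷ q) zero    = sym (∧-identityʳ x)
lookup-─ (x V.∷ p) (_     V.∷ q) (suc i) = lookup-─ p q i

factorᵇ-split : ∀ (i : Fin n) s t s₀ t₀ →
                (s ≡ true → t ≡ false) → (s₀ ≡ true → s ≡ true) → (t₀ ≡ true → t ≡ true) →
                factorᵇ s t i ≋ factorᵇ (s ∧ not s₀) (t ∧ not t₀) i ⊗ factorᵇ s₀ t₀ i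
factorᵇ-split i true  true  _     _     s#t _    _    = contradiction (s#t refl) λ ()
factorᵇ-split i true  false _     true  _   _    t₀⇒t = contradiction (t₀⇒t refl) λ ()
factorᵇ-split i true  false true  false _   _    _    = ≡⇒≋ (sym (⊗-identityˡ (var i)))
factorᵇ-split i true  false false false _   _    _    = ≡⇒≋ (sym (⊗-identityʳ (var i)))
factorᵇ-split i false _     true  _     _   s₀⇒s _    = contradiction (s₀⇒s refl) λ ()
factorᵇ-split i false true  false true  _   _    _    = ≡⇒≋ (sym (⊗-identityˡ (oneMinus i)))
factorᵇ-split i false true  false false _   _    _    = ≡⇒≋ (sym (⊗-identityʳ (oneMinus i)))
factorᵇ-split i false false false true  _   _    t₀⇒t = contradiction (t₀⇒t refl) λ ()
factorᵇ-split i false false false false _   _    _    = ≡⇒≋ (sym (⊗-identityˡ one))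

pm-∣-pm : Disjoint σ τ → σ₀ ⊆ σ → τ₀ ⊆ τ → pm σ₀ τ₀ ∣ pm σ τ
pm-∣-pm {σ = σ} {τ = τ} {σ₀ = σ₀} {τ₀ = τ₀} σ#τ σ₀⊆σ τ₀⊆τ =
  pm (σ ─ σ₀) (τ ─ τ₀) ,
  coeff-≡ (prod-⊗ (factor σ τ) (factor (σ ─ σ₀) (τ ─ τ₀)) (factor σ₀ τ₀) (L.allFin _) split)
  where
  split : ∀ i → factor σ τ i ≋ factor (σ ─ σ₀) (τ ─ τ₀) i ⊗ factor σ₀ τ₀ i
  split i = ≋-trans
    (factorᵇ-split i (V.lookup σ i) (V.lookup τ i) (V.lookup σ₀ i) (V.lookup τ₀ i)
      (lookup-∉ ∘ σ#τ i ∘ lookup⇒[]= i σ) ([]=⇒lookup ∘ σ₀⊆σ ∘ lookup⇒[]= i σ₀)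
      ([]=⇒lookup ∘ τ₀⊆τ ∘ lookup⇒[]= i τ₀))
    (⊗-congˡ (factor σ₀ τ₀ i)
      (≡⇒≋ (sym (factor-≡ (σ ─ σ₀) (τ ─ τ₀) i (lookup-─ σ σ₀ i) (lookup-─ τ τ₀ i)))))

pm-∣-pm⇒⊆ : Disjoint σ τ → Disjoint σ₀ τ₀ → pm σ₀ τ₀ ∣ pm σ τ → σ₀ ⊆ σ × τ₀ ⊆ τ
pm-∣-pm⇒⊆ {σ = σ} {τ = τ} {σ₀ = σ₀} {τ₀ = τ₀} σ#τ σ₀#τ₀ div =
  proj₁ (true-at ⊆-refl (Disjoint-sym σ#τ)) , τ₀⊆τ
  where
  true-at : ∀ {p} → σ ⊆ p → Disjoint τ p → σ₀ ⊆ p × Disjoint τ₀ p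
  true-at {p} σ⊆p τ#p = eval-pm⁻ σ₀#τ₀ (eval-∣ {g = pm σ₀ τ₀} {f = pm σ τ} p div (eval-pm⁺ σ⊆p τ#p))
  -- a coordinate j of τ₀ outside τ could be switched on without killing pm σ τ
  τ₀⊆τ : τ₀ ⊆ τ
  τ₀⊆τ {j} j∈τ₀ with j ∈? τ
  ... | yes j∈τ = j∈τ
  ... | no  j∉τ =
    contradiction (x∈p∪q⁺ (inj₂ (x∈⁅x⁆ j))) (proj₂ (true-at (p⊆p∪q ⁅ j ⁆) τ#σ∪j) j j∈τ₀)
    where
    τ#σ∪j : Disjoint τ (σ ∪ ⁅ j ⁆)
    τ#σ∪j i i∈τ i∈σ∪j with x∈p∪q⁻ σ ⁅ j ⁆ i∈σ∪j
    ... | inj₁ i∈σ = σ#τ i i∈σ i∈τ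
    ... | inj₂ i∈j = j∉τ (subst (_∈ τ) (x∈⁅y⁆⇒x≡y j i∈j) i∈τ)

pm-single : ∀ (σ τ : Subset n) i → (∀ j → j ≢ i → j ∉ σ × j ∉ τ) → pm σ τ ≋ factor σ τ i
pm-single σ τ i off = prod-single (factor σ τ) i (allFin⁺ _) (∈-allFin i) λ j j≢i →
  ≡⇒≋ (factor-≡ σ τ j (lookup-∉ (proj₁ (off j j≢i))) (lookup-∉ (proj₂ (off j j≢i))))

var≋pm : ∀ (i : Fin n) → var i ≋ pm ⁅ i ⁆ ∅
var≋pm i = ≋-sym (≋-trans (pm-single ⁅ i ⁆ ∅ i λ j j≢i → x≢y⇒x∉⁅y⁆ j≢i , ∉⊥)
                          (≡⇒≋ (factor-≡ ⁅ i ⁆ ∅ i ([]=⇒lookup (x∈⁅x⁆ i)) (lookup-∉ {i = i} {p = ∅} ∉⊥))))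

oneMinus≋pm : ∀ (i : Fin n) → oneMinus i ≋ pm ∅ ⁅ i ⁆
oneMinus≋pm i = ≋-sym (≋-trans (pm-single ∅ ⁅ i ⁆ i λ j j≢i → ∉⊥ , x≢y⇒x∉⁅y⁆ j≢i)
                               (≡⇒≋ (factor-≡ ∅ ⁅ i ⁆ i (lookup-∉ {i = i} {p = ∅} ∉⊥) ([]=⇒lookup (x∈⁅x⁆ i)))))

⁅⁆⊆⇔∈ : ⁅ i ⁆ ⊆ σ ⇔ i ∈ σ
⁅⁆⊆⇔∈ {i = i} {σ = σ} =
  mk⇔ (λ i⊆σ → i⊆σ (x∈⁅x⁆ i)) λ i∈σ {j} j∈i → subst (_∈ σ) (sym (x∈⁅y⁆⇒x≡y i j∈i)) i∈σ

var∣pm⇔∈ : Disjoint σ τ → var i ∣ pm σ τ ⇔ i ∈ σ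
var∣pm⇔∈ {σ = σ} {τ = τ} {i = i} σ#τ = mk⇔
  (λ div → Equivalence.to ⁅⁆⊆⇔∈
     (proj₁ (pm-∣-pm⇒⊆ σ#τ (λ _ _ → ∉⊥) (∣-respˡ-≋ {f = pm σ τ} (var≋pm i) div))))
  (λ i∈σ → ∣-respˡ-≋ {f = pm σ τ} (≋-sym (var≋pm i)) (pm-∣-pm σ#τ (Equivalence.from ⁅⁆⊆⇔∈ i∈σ) ⊥⊆))

oneMinus∣pm⇔∈ : Disjoint σ τ → oneMinus i ∣ pm σ τ ⇔ i ∈ τ
oneMinus∣pm⇔∈ {σ = σ} {τ = τ} {i = i} σ#τ = mk⇔
  (λ div → Equivalence.to ⁅⁆⊆⇔∈
     (proj₂ (pm-∣-pm⇒⊆ σ#τ (λ _ i∈∅ _ → ∉⊥ i∈∅) (∣-respˡ-≋ {f = pm σ τ} (oneMinus≋pm i) div))))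
  (λ i∈τ → ∣-respˡ-≋ {f = pm σ τ} (≋-sym (oneMinus≋pm i)) (pm-∣-pm σ#τ ⊥⊆ (Equivalence.from ⁅⁆⊆⇔∈ i∈τ)))

-- Pseudo-monomials in a neural ideal

lookup-∪⁅⁆ : ∀ {j} → j ≢ i → V.lookup (σ ∪ ⁅ i ⁆) j ≡ V.lookup σ j
lookup-∪⁅⁆ {i = i} {σ = σ} {j} j≢i =
  trans (lookup-zipWith _∨_ j σ ⁅ i ⁆) (trans (cong (_ ∨_) (lookup-∉ (x≢y⇒x∉⁅y⁆ j≢i))) (∨-identityʳ _))

∈-∪⁅⁆ : ∀ (σ : Subset n) i → i ∈ σ ∪ ⁅ i ⁆
∈-∪⁅⁆ σ i = x∈p∪q⁺ (inj₂ (x∈⁅x⁆ i))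

one≋var⊕oneMinus : ∀ (i : Fin n) → one ≋ var i ⊕ oneMinus i
one≋var⊕oneMinus i = ≋-sym (begin
  var i ⊕ (one ⊕ var i)   ≈⟨ ⊕-Properties.x∙yz≈y∙xz (var i) one (var i) ⟩
  one ⊕ (var i ⊕ var i)   ≈⟨ ⊕-cong ≋-refl (⊕-self (var i)) ⟩
  one ⊕ []                ≡⟨ ++-identityʳ one ⟩
  one                     ∎)
  where open ≋-Reasoning

-- 1 = x_i + (1 - x_i)
pm-split : i ∉ σ → i ∉ τ → pm σ τ ≋ pm (σ ∪ ⁅ i ⁆) τ ⊕ pm σ (τ ∪ ⁅ i ⁆)
pm-split {i = i} {σ = σ} {τ = τ} i∉σ i∉τ =
  prod-linear-at (factor σ τ) (factor (σ ∪ ⁅ i ⁆) τ) (factor σ (τ ∪ ⁅ i ⁆)) i (allFin⁺ _) (∈-allFin i)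
    (λ j j≢i → ≡⇒≋ (sym (factor-≡ (σ ∪ ⁅ i ⁆) τ j (lookup-∪⁅⁆ {σ = σ} j≢i) refl)))
    (λ j j≢i → ≡⇒≋ (sym (factor-≡ σ (τ ∪ ⁅ i ⁆) j refl (lookup-∪⁅⁆ {σ = τ} j≢i))))
    (begin
      factor σ τ i                                  ≡⟨ factor-≡ σ τ i (lookup-∉ i∉σ) (lookup-∉ i∉τ) ⟩
      one                                           ≈⟨ one≋var⊕oneMinus i ⟩
      var i ⊕ oneMinus i                            ≡⟨ cong₂ _⊕_ var-factor oneMinus-factor ⟨
      factor (σ ∪ ⁅ i ⁆) τ i ⊕ factor σ (τ ∪ ⁅ i ⁆) i ∎)
  where
  open ≋-Reasoning
  var-factor : factor (σ ∪ ⁅ i ⁆) τ i ≡ var i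
  var-factor = factor-≡ (σ ∪ ⁅ i ⁆) τ i ([]=⇒lookup (∈-∪⁅⁆ σ i)) (lookup-∉ i∉τ)
  oneMinus-factor : factor σ (τ ∪ ⁅ i ⁆) i ≡ oneMinus i
  oneMinus-factor = factor-≡ σ (τ ∪ ⁅ i ⁆) i (lookup-∉ i∉σ) ([]=⇒lookup (∈-∪⁅⁆ τ i))

combination : List (Poly n × Subset n) → Poly n
combination gs = L.foldr _⊕_ [] (L.map (λ (h , v) → h ⊗ ρ v) gs)

combination-++ : ∀ (gs hs : List (Poly n × Subset n)) → combination (gs ++ hs) ≡ combination gs ⊕ combination hs
combination-++ []             hs = refl
combination-++ ((h , v) ∷ gs) hs = trans (cong (h ⊗ ρ v ⊕_) (combination-++ gs hs)) (sym (++-assoc (h ⊗ ρ v) _ _))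

Disjoint-∪⁅⁆ˡ : i ∉ τ → Disjoint σ τ → Disjoint (σ ∪ ⁅ i ⁆) τ
Disjoint-∪⁅⁆ˡ {i = i} {τ = τ} {σ = σ} i∉τ σ#τ j j∈σ∪i =
  [ σ#τ j , (λ j∈i → subst (_∉ τ) (sym (x∈⁅y⁆⇒x≡y i j∈i)) i∉τ) ]′ (x∈p∪q⁻ σ ⁅ i ⁆ j∈σ∪i)

Disjoint-∪⁅⁆ʳ : i ∉ σ → Disjoint σ τ → Disjoint σ (τ ∪ ⁅ i ⁆)
Disjoint-∪⁅⁆ʳ i∉σ σ#τ = Disjoint-sym (Disjoint-∪⁅⁆ˡ i∉σ (Disjoint-sym σ#τ))

covers⇒≡∁ : Disjoint σ τ → (∀ j → j ∈ σ ⊎ j ∈ τ) → τ ≡ ∁ σ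
covers⇒≡∁ σ#τ covers = ⊆-antisym (λ {j} j∈τ → x∉p⇒x∈∁p (Disjoint-sym σ#τ j j∈τ))
  λ {j} j∈∁σ → [ (λ j∈σ → contradiction j∈σ (x∈∁p⇒x∉p j∈∁σ)) , id ]′ (covers j)

covered-by-∷ : ∀ {P : Fin n → Set} {i js} → (∀ j → ¬ j ∈ₗ i ∷ js → P j) → P i → ∀ j → ¬ j ∈ₗ js → P j
covered-by-∷ {i = i} covers Pi j j∉js with j ≟ i
... | yes refl = Pi
... | no  j≢i  = covers j λ { (here j≡i) → j≢i j≡i ; (there j∈js) → j∉js j∈js }

-- The expansion of pm σ τ as the sum of ρ v over the points v of its box; the
-- coordinates in js are those still free to be split on.
pm-expansion : ∀ (js : List (Fin n)) → Disjoint σ τ → (∀ j → ¬ j ∈ₗ js → j ∈ σ ⊎ j ∈ τ) →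
               Σ (List (Poly n × Subset n)) λ gs →
                 All (λ (_ , v) → σ ⊆ v × Disjoint τ v) gs × pm σ τ ≋ combination gs
pm-expansion {σ = σ} {τ = τ} [] σ#τ covers =
  (one , σ) ∷ [] , (⊆-refl , Disjoint-sym σ#τ) ∷ [] ,
  ≡⇒≋ (trans (cong (pm σ) (covers⇒≡∁ σ#τ λ j → covers j λ ()))
             (sym (trans (++-identityʳ _) (⊗-identityˡ (ρ σ)))))
pm-expansion {σ = σ} {τ = τ} (i ∷ js) σ#τ covers with i ∈? σ | i ∈? τ
... | yes i∈σ | _       = pm-expansion js σ#τ (covered-by-∷ covers (inj₁ i∈σ))
... | no  i∉σ | yes i∈τ = pm-expansion js σ#τ (covered-by-∷ covers (inj₂ i∈τ))
... | no  i∉σ | no  i∉τ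
    with pm-expansion js (Disjoint-∪⁅⁆ˡ i∉τ σ#τ)
           (covered-by-∷ (λ j → Sum.map₁ (p⊆p∪q ⁅ i ⁆) ∘ covers j) (inj₁ (∈-∪⁅⁆ σ i)))
       | pm-expansion js (Disjoint-∪⁅⁆ʳ i∉σ σ#τ)
           (covered-by-∷ (λ j → Sum.map₂ (p⊆p∪q ⁅ i ⁆) ∘ covers j) (inj₂ (∈-∪⁅⁆ τ i)))
... | gs₁ , in-box₁ , pm≋₁ | gs₂ , in-box₂ , pm≋₂ =
  gs₁ ++ gs₂ ,
  ++⁺ (All.map (Product.map₁ (⊆-trans (p⊆p∪q ⁅ i ⁆))) in-box₁)
      (All.map (Product.map₂ λ τ∪i#v j j∈τ → τ∪i#v j (p⊆p∪q ⁅ i ⁆ j∈τ)) in-box₂) ,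
  (begin
    pm σ τ                                  ≈⟨ pm-split i∉σ i∉τ ⟩
    pm (σ ∪ ⁅ i ⁆) τ ⊕ pm σ (τ ∪ ⁅ i ⁆)     ≈⟨ ⊕-cong pm≋₁ pm≋₂ ⟩
    combination gs₁ ⊕ combination gs₂       ≡⟨ combination-++ gs₁ gs₂ ⟨
    combination (gs₁ ++ gs₂)                ∎)
  where open ≋-Reasoning

VanishesOn : Code n → Poly n → Set
VanishesOn C f = ∀ c → c ∈C C → eval c f ≡ false

T-eval-ρ⇒≡ : ∀ (c v : Subset n) → T (eval c (ρ v)) → v ≡ c
T-eval-ρ⇒≡ c v t =
  let v⊆c , ∁v#c = eval-pm⁻ (λ _ → x∈p⇒x∉∁p) t
  in ⊆-antisym v⊆c λ {i} i∈c → x∉∁p⇒x∈p λ i∈∁v → ∁v#c i i∈∁v i∈c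

NeuralIdeal⇒VanishesOn : ∀ (C : Code n) f → NeuralIdeal C f → VanishesOn C f
NeuralIdeal⇒VanishesOn C f (gs , gens∉C , f≈Σ) c c∈C =
  trans (eval-cong c (coeffwise {p = f} {q = combination gs} f≈Σ)) (vanish gs gens∉C)
  where
  ρ-vanishes : ∀ v → v ∉C C → eval c (ρ v) ≡ false
  ρ-vanishes v v∉C with eval c (ρ v) in eq
  ... | true  = contradiction (subst (_∈C C) (sym (T-eval-ρ⇒≡ c v (subst T (sym eq) _))) c∈C) v∉C
  ... | false = refl
  vanish : ∀ gs → All (λ (_ , v) → v ∉C C) gs → eval c (combination gs) ≡ false
  vanish []             []             = refl
  vanish ((h , v) ∷ gs) (v∉C ∷ gens∉C) = begin
    eval c (h ⊗ ρ v ⊕ combination gs)                ≡⟨ eval-⊕ c (h ⊗ ρ v) _ ⟩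
    eval c (h ⊗ ρ v) xor eval c (combination gs)     ≡⟨ cong₂ _xor_ (eval-⊗ c h (ρ v)) (vanish gs gens∉C) ⟩
    (eval c h ∧ eval c (ρ v)) xor false              ≡⟨ cong (λ b → (eval c h ∧ b) xor false) (ρ-vanishes v v∉C) ⟩
    (eval c h ∧ false) xor false                     ≡⟨ cong (_xor false) (∧-zeroʳ (eval c h)) ⟩
    false                                            ∎
    where open ≡-Reasoning

VanishesOn⇒NeuralIdeal : ∀ (C : Code n) → Disjoint σ τ → VanishesOn C (pm σ τ) → NeuralIdeal C (pm σ τ)
VanishesOn⇒NeuralIdeal {σ = σ} {τ = τ} C σ#τ vanishes
  with pm-expansion (L.allFin _) σ#τ (λ j j∉ → contradiction (∈-allFin j) j∉)
... | gs , in-box , pm≋Σ =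
  gs ,
  All.map (λ (σ⊆v , τ#v) v∈C → subst T (vanishes _ v∈C) (eval-pm⁺ σ⊆v τ#v)) in-box ,
  coeff-≡ pm≋Σ

NeuralIdeal-resp-≋ : ∀ (C : Code n) → f ≋ g → NeuralIdeal C f → NeuralIdeal C g
NeuralIdeal-resp-≋ {f = f} C f≋g (gs , gens∉C , f≈Σ) =
  gs , gens∉C , coeff-≡ (≋-trans (≋-sym f≋g) (coeffwise {p = f} {q = combination gs} f≈Σ))

-- Deleting the last neuron

lookup-∷ʳ-inject₁ : ∀ {A : Set} (xs : Vec A n) x i → V.lookup (xs ∷ʳ x) (inject₁ i) ≡ V.lookup xs i
lookup-∷ʳ-inject₁ (_ V.∷ xs) x zero    = refl
lookup-∷ʳ-inject₁ (_ V.∷ xs) x (suc i) = lookup-∷ʳ-inject₁ xs x i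

lookup-∷ʳ-fromℕ : ∀ {A : Set} (xs : Vec A n) x → V.lookup (xs ∷ʳ x) (fromℕ n) ≡ x
lookup-∷ʳ-fromℕ V.[]       x = refl
lookup-∷ʳ-fromℕ (_ V.∷ xs) x = lookup-∷ʳ-fromℕ xs x

fromℕ∉∷ʳfalse : ∀ (σ : Subset n) → fromℕ n ∉ σ ∷ʳ false
fromℕ∉∷ʳfalse σ ℓ∈σ with () ← trans (sym ([]=⇒lookup ℓ∈σ)) (lookup-∷ʳ-fromℕ σ false)

∈-∷ʳ⁺ : ∀ {x} → i ∈ σ → inject₁ i ∈ σ ∷ʳ x
∈-∷ʳ⁺ {i = i} {σ = σ} {x} i∈σ = lookup⇒[]= (inject₁ i) (σ ∷ʳ x) (trans (lookup-∷ʳ-inject₁ σ x i) ([]=⇒lookup i∈σ))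

∈-∷ʳ⁻ : ∀ {x} → inject₁ i ∈ σ ∷ʳ x → i ∈ σ
∈-∷ʳ⁻ {i = i} {σ = σ} {x} i∈σ = lookup⇒[]= i σ (trans (sym (lookup-∷ʳ-inject₁ σ x i)) ([]=⇒lookup i∈σ))

∷ʳ-⊆⁻ : ∀ {x y} → σ ∷ʳ x ⊆ τ ∷ʳ y → σ ⊆ τ
∷ʳ-⊆⁻ σ⊆τ = ∈-∷ʳ⁻ ∘ σ⊆τ ∘ ∈-∷ʳ⁺

Disjoint-∷ʳ⁻ : ∀ {x y} → Disjoint (σ ∷ʳ x) (τ ∷ʳ y) → Disjoint σ τ
Disjoint-∷ʳ⁻ σ#τ i i∈σ i∈τ = σ#τ (inject₁ i) (∈-∷ʳ⁺ i∈σ) (∈-∷ʳ⁺ i∈τ)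

Disjoint-∷ʳ⁺ : Disjoint σ τ → Disjoint (σ ∷ʳ false) (τ ∷ʳ false)
Disjoint-∷ʳ⁺ {σ = V.[]}      {τ = V.[]}      _   zero    ()
Disjoint-∷ʳ⁺ {σ = _ V.∷ _}   {τ = _ V.∷ _}   σ#τ zero    here      here      = σ#τ zero here here
Disjoint-∷ʳ⁺ {σ = _ V.∷ _}   {τ = _ V.∷ _}   σ#τ (suc i) (there p) (there q) =
  Disjoint-∷ʳ⁺ (λ j p q → σ#τ (suc j) (there p) (there q)) i p q

∉fromℕ⇒∷ʳ : fromℕ n ∉ σ → Σ (Subset n) λ σ₀ → σ ≡ σ₀ ∷ʳ false
∉fromℕ⇒∷ʳ {σ = x V.∷ V.[]}    ℓ∉σ = V.[] , cong (V._∷ V.[]) (lookup-∉ ℓ∉σ)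
∉fromℕ⇒∷ʳ {σ = x V.∷ y V.∷ σ} ℓ∉σ with ∉fromℕ⇒∷ʳ {σ = y V.∷ σ} (ℓ∉σ ∘ there)
... | σ₀ , eq = x V.∷ σ₀ , cong (x V.∷_) eq

∣∷ʳfalse∣ : ∀ (σ : Subset n) → ∣ σ ∷ʳ false ∣ ≡ ∣ σ ∣
∣∷ʳfalse∣ V.[]          = refl
∣∷ʳfalse∣ (true  V.∷ σ) = cong suc (∣∷ʳfalse∣ σ)
∣∷ʳfalse∣ (false V.∷ σ) = ∣∷ʳfalse∣ σ

deg-∷ʳ : ∀ (σ τ : Subset n) → deg (σ ∷ʳ false) (τ ∷ʳ false) ≡ deg σ τ
deg-∷ʳ σ τ = cong₂ ℕ._+_ (∣∷ʳfalse∣ σ) (∣∷ʳfalse∣ τ)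

ι-cong : ∀ {p q : Poly n} → p ≋ q → ι p ≋ ι q
ι-cong = additive-cong ι (map-additive (_∷ʳ 0))

ι-⊗ : ∀ (p q : Poly n) → ι (p ⊗ q) ≡ ι p ⊗ ι q
ι-⊗ []      q = refl
ι-⊗ (a ∷ p) q = trans (map-++ (_∷ʳ 0) (L.map (a +ᵉ_) q) (p ⊗ q)) (cong₂ _⊕_ ι-map-+ᵉ (ι-⊗ p q))
  where
  +ᵉ-∷ʳ : ∀ {n} (a b : Mono n) → (a +ᵉ b) ∷ʳ 0 ≡ (a ∷ʳ 0) +ᵉ (b ∷ʳ 0)
  +ᵉ-∷ʳ V.[]      V.[]      = refl
  +ᵉ-∷ʳ (x V.∷ a) (y V.∷ b) = cong (x ℕ.+ y V.∷_) (+ᵉ-∷ʳ a b)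
  ι-map-+ᵉ : ι (L.map (a +ᵉ_) q) ≡ L.map ((a ∷ʳ 0) +ᵉ_) (ι q)
  ι-map-+ᵉ = trans (sym (map-∘ q)) (trans (map-cong (+ᵉ-∷ʳ a) q) (map-∘ q))

ι-one : ι (one {n}) ≡ one
ι-one {n} = cong (_∷ []) (replicate-∷ʳ n)
  where
  replicate-∷ʳ : ∀ n → V.replicate n 0 ∷ʳ 0 ≡ V.replicate (suc n) 0
  replicate-∷ʳ zero    = refl
  replicate-∷ʳ (suc n) = cong (0 V.∷_) (replicate-∷ʳ n)

ι-var : ∀ (i : Fin n) → ι (var i) ≡ var (inject₁ i)
ι-var i = cong (_∷ []) (exponent-∷ʳ i)
  where
  exponent-∷ʳ : ∀ {n} (i : Fin n) → V.tabulate (λ j → if does (i ≟ j) then 1 else 0) ∷ʳ 0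
                                  ≡ V.tabulate (λ j → if does (inject₁ i ≟ j) then 1 else 0)
  exponent-∷ʳ {suc n} zero    = cong (1 V.∷_) (zeros n)
    where
    zeros : ∀ n → V.tabulate {n = n} (λ _ → 0) ∷ʳ 0 ≡ V.tabulate {n = suc n} (λ _ → 0)
    zeros zero    = refl
    zeros (suc n) = cong (0 V.∷_) (zeros n)
  exponent-∷ʳ {suc n} (suc i) = cong (0 V.∷_) (exponent-∷ʳ i)

ι-factorᵇ : ∀ s t (i : Fin n) → ι (factorᵇ s t i) ≡ factorᵇ s t (inject₁ i)
ι-factorᵇ true  t     i = ι-var i
ι-factorᵇ false true  i = cong₂ _⊕_ ι-one (ι-var i)
ι-factorᵇ false false i = ι-one

ι-prod : ∀ (Fs : List (Poly n)) → ι (prod Fs) ≡ prod (L.map ι Fs)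
ι-prod []       = ι-one
ι-prod (F ∷ Fs) = trans (ι-⊗ F (prod Fs)) (cong (ι F ⊗_) (ι-prod Fs))

tabulate-∷ʳ : ∀ {A : Set} (f : Fin (suc n) → A) → L.tabulate f ≡ L.tabulate (f ∘ inject₁) L.∷ʳ f (fromℕ n)
tabulate-∷ʳ {n = zero}  f = refl
tabulate-∷ʳ {n = suc n} f = cong (f zero ∷_) (tabulate-∷ʳ (f ∘ suc))

pm-tabulate : ∀ (σ τ : Subset n) → pm σ τ ≡ prod (L.tabulate (factor σ τ))
pm-tabulate σ τ = cong prod (map-tabulate id (factor σ τ))

ι-pm : ∀ (σ τ : Subset n) → ι (pm σ τ) ≡ pm (σ ∷ʳ false) (τ ∷ʳ false)
ι-pm {n} σ τ = begin
  ι (pm σ τ)                                       ≡⟨ cong ι (pm-tabulate σ τ) ⟩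
  ι (prod (L.tabulate (factor σ τ)))               ≡⟨ ι-prod (L.tabulate (factor σ τ)) ⟩
  prod (L.map ι (L.tabulate (factor σ τ)))         ≡⟨ cong prod (map-tabulate (factor σ τ) ι) ⟩
  prod (L.tabulate (ι ∘ factor σ τ))               ≡⟨ cong prod (tabulate-cong ι-factor) ⟩
  prod (L.tabulate (F ∘ inject₁))                  ≡⟨ cong (λ e → L.foldr _⊗_ e (L.tabulate (F ∘ inject₁))) F-last ⟨
  L.foldr _⊗_ (F (fromℕ n) ⊗ one) (L.tabulate (F ∘ inject₁))
                                                   ≡⟨ foldr-++ _⊗_ one (L.tabulate (F ∘ inject₁)) (F (fromℕ n) ∷ []) ⟨
  prod (L.tabulate (F ∘ inject₁) L.∷ʳ F (fromℕ n)) ≡⟨ cong prod (tabulate-∷ʳ F) ⟨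
  prod (L.tabulate F)                              ≡⟨ pm-tabulate (σ ∷ʳ false) (τ ∷ʳ false) ⟨
  pm (σ ∷ʳ false) (τ ∷ʳ false)                     ∎
  where
  open ≡-Reasoning
  F = factor (σ ∷ʳ false) (τ ∷ʳ false)
  F-last : F (fromℕ n) ⊗ one ≡ one
  F-last = trans (⊗-identityʳ _)
    (factor-≡ (σ ∷ʳ false) (τ ∷ʳ false) (fromℕ n) (lookup-∷ʳ-fromℕ σ false) (lookup-∷ʳ-fromℕ τ false))
  ι-factor : ∀ i → ι (factor σ τ i) ≡ F (inject₁ i)
  ι-factor i = trans (ι-factorᵇ (V.lookup σ i) (V.lookup τ i) i)
    (sym (factor-≡ (σ ∷ʳ false) (τ ∷ʳ false) (inject₁ i) (lookup-∷ʳ-inject₁ σ false i) (lookup-∷ʳ-inject₁ τ false i)))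

ι-∣ : g ∣ f → ι g ∣ ι f
ι-∣ {g = g} {f = f} (h , f≈hg) =
  ι h , coeff-≡ (≋-trans (ι-cong (coeffwise {p = f} {q = h ⊗ g} f≈hg)) (≡⇒≋ (ι-⊗ h g)))

eval-ι : ∀ (c : Subset (suc n)) f → eval c (ι f) ≡ eval (V.init c) f
eval-ι c f = trans (cong (λ c → eval c (ι f)) (proj₂ (proj₂ (V.initLast c)))) (eval-∷ʳ (V.init c) (V.last c) f)
  where
  evalMono-∷ʳ : ∀ {n} (c : Subset n) b a → evalMono (c ∷ʳ b) (a ∷ʳ 0) ≡ evalMono c a
  evalMono-∷ʳ V.[]      b V.[]      = refl
  evalMono-∷ʳ (x V.∷ c) b (e V.∷ a) = cong (x ^ᵇ e ∧_) (evalMono-∷ʳ c b a)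
  eval-∷ʳ : ∀ {n} (c : Subset n) b f → eval (c ∷ʳ b) (ι f) ≡ eval c f
  eval-∷ʳ c b []      = refl
  eval-∷ʳ c b (a ∷ f) = cong₂ _xor_ (evalMono-∷ʳ c b a) (eval-∷ʳ c b f)

VanishesOn-ι⇔ : ∀ (C : Code (suc n)) f → VanishesOn C (ι f) ⇔ VanishesOn (deleteLast C) f
VanishesOn-ι⇔ C f = mk⇔
  (λ vanish d d∈D → case ∈-map⁻ V.init d∈D of λ where
     (c , c∈C , refl) → trans (sym (eval-ι c f)) (vanish c c∈C))
  (λ vanish c c∈C → trans (eval-ι c f) (vanish (V.init c) (∈-map⁺ V.init c∈C)))

NeuralIdeal-ι-pm⇔ : ∀ (C : Code (suc n)) → Disjoint σ τ →
                    NeuralIdeal C (pm (σ ∷ʳ false) (τ ∷ʳ false)) ⇔ NeuralIdeal (deleteLast C) (pm σ τ)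
NeuralIdeal-ι-pm⇔ {σ = σ} {τ = τ} C σ#τ = mk⇔
  (λ J → VanishesOn⇒NeuralIdeal (deleteLast C) σ#τ
           (Equivalence.to (VanishesOn-ι⇔ C (pm σ τ)) (subst (VanishesOn C) (sym (ι-pm σ τ))
             (NeuralIdeal⇒VanishesOn C (pm (σ ∷ʳ false) (τ ∷ʳ false)) J))))
  (λ J → VanishesOn⇒NeuralIdeal C (Disjoint-∷ʳ⁺ σ#τ)
           (subst (VanishesOn C) (ι-pm σ τ) (Equivalence.from (VanishesOn-ι⇔ C (pm σ τ))
             (NeuralIdeal⇒VanishesOn (deleteLast C) (pm σ τ) J))))

MinimalIn : (Poly n → Set) → Subset n → Subset n → Set
MinimalIn J σ τ = J (pm σ τ) ×
  (∀ σ′ τ′ → Disjoint σ′ τ′ → J (pm σ′ τ′) → deg σ′ τ′ < deg σ τ → ¬ (pm σ′ τ′ ∣ pm σ τ))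

InCF⇔ : ∀ (C : Code n) f → InCF (NeuralIdeal C) f ⇔
        (Σ (Subset n) λ σ → Σ (Subset n) λ τ → Disjoint σ τ × f ≋ pm σ τ × MinimalIn (NeuralIdeal C) σ τ)
InCF⇔ C f = mk⇔
  (λ (σ , τ , σ#τ , f≈pm , J , minimal) → let f≋pm = coeffwise {p = f} {q = pm σ τ} f≈pm in
     σ , τ , σ#τ , f≋pm , NeuralIdeal-resp-≋ C f≋pm J ,
     λ σ′ τ′ σ′#τ′ J′ deg< → minimal σ′ τ′ σ′#τ′ J′ deg< ∘ ∣-respʳ-≋ (≋-sym f≋pm))
  (λ (σ , τ , σ#τ , f≋pm , J , minimal) →
     σ , τ , σ#τ , coeff-≡ f≋pm , NeuralIdeal-resp-≋ C (≋-sym f≋pm) J ,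
     λ σ′ τ′ σ′#τ′ J′ deg< → minimal σ′ τ′ σ′#τ′ J′ deg< ∘ ∣-respʳ-≋ f≋pm)

MinimalIn-∷ʳ⁺ : ∀ (C : Code (suc n)) → Disjoint σ τ →
                MinimalIn (NeuralIdeal (deleteLast C)) σ τ → MinimalIn (NeuralIdeal C) (σ ∷ʳ false) (τ ∷ʳ false)
MinimalIn-∷ʳ⁺ {σ = σ} {τ = τ} C σ#τ (J , minimal) = Equivalence.from (NeuralIdeal-ι-pm⇔ C σ#τ) J , minimal′
  where
  minimal′ : ∀ σ′ τ′ → Disjoint σ′ τ′ → NeuralIdeal C (pm σ′ τ′) →
             deg σ′ τ′ < deg (σ ∷ʳ false) (τ ∷ʳ false) → ¬ (pm σ′ τ′ ∣ pm (σ ∷ʳ false) (τ ∷ʳ false))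
  -- a pseudo-monomial dividing pm (σ ∷ʳ false) (τ ∷ʳ false) does not involve the last variable either
  minimal′ σ′ τ′ σ′#τ′ J′ deg< div
    with pm-∣-pm⇒⊆ {σ = σ ∷ʳ false} {τ = τ ∷ʳ false} (Disjoint-∷ʳ⁺ σ#τ) σ′#τ′ div
  ... | σ′⊆ , τ′⊆ with ∉fromℕ⇒∷ʳ (fromℕ∉∷ʳfalse σ ∘ σ′⊆) | ∉fromℕ⇒∷ʳ (fromℕ∉∷ʳfalse τ ∘ τ′⊆)
  ... | σ₀ , refl | τ₀ , refl =
    minimal σ₀ τ₀ (Disjoint-∷ʳ⁻ σ′#τ′) (Equivalence.to (NeuralIdeal-ι-pm⇔ C (Disjoint-∷ʳ⁻ σ′#τ′)) J′)
      (subst₂ _<_ (deg-∷ʳ σ₀ τ₀) (deg-∷ʳ σ τ) deg<) (pm-∣-pm σ#τ (∷ʳ-⊆⁻ σ′⊆) (∷ʳ-⊆⁻ τ′⊆))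

MinimalIn-∷ʳ⁻ : ∀ (C : Code (suc n)) → Disjoint σ τ →
                MinimalIn (NeuralIdeal C) (σ ∷ʳ false) (τ ∷ʳ false) → MinimalIn (NeuralIdeal (deleteLast C)) σ τ
MinimalIn-∷ʳ⁻ {σ = σ} {τ = τ} C σ#τ (J , minimal) =
  Equivalence.to (NeuralIdeal-ι-pm⇔ C σ#τ) J ,
  λ σ′ τ′ σ′#τ′ J′ deg< div →
    minimal (σ′ ∷ʳ false) (τ′ ∷ʳ false) (Disjoint-∷ʳ⁺ σ′#τ′) (Equivalence.from (NeuralIdeal-ι-pm⇔ C σ′#τ′) J′)
      (subst₂ _<_ (sym (deg-∷ʳ σ′ τ′)) (sym (deg-∷ʳ σ τ)) deg<)
      (subst₂ _∣_ (ι-pm σ′ τ′) (ι-pm σ τ) (ι-∣ {g = pm σ′ τ′} {f = pm σ τ} div))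

InCF-ι⁺ : ∀ (C : Code (suc n)) β f → InCF (NeuralIdeal (deleteLast C)) β → f ≈ ι β →
          InCF (NeuralIdeal C) f × ¬ (var (fromℕ n) ∣ f) × ¬ (oneMinus (fromℕ n) ∣ f)
InCF-ι⁺ C β f β∈CF f≈ιβ with Equivalence.to (InCF⇔ (deleteLast C) β) β∈CF
... | σ , τ , σ#τ , β≋pm , minimal =
  Equivalence.from (InCF⇔ C f) (σ ∷ʳ false , τ ∷ʳ false , σ′#τ′ , f≋pm , MinimalIn-∷ʳ⁺ C σ#τ minimal) ,
  fromℕ∉∷ʳfalse σ ∘ Equivalence.to (var∣pm⇔∈ σ′#τ′) ∘ ∣-respʳ-≋ f≋pm ,
  fromℕ∉∷ʳfalse τ ∘ Equivalence.to (oneMinus∣pm⇔∈ σ′#τ′) ∘ ∣-respʳ-≋ f≋pm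
  where
  σ′#τ′ = Disjoint-∷ʳ⁺ σ#τ
  f≋pm : f ≋ pm (σ ∷ʳ false) (τ ∷ʳ false)
  f≋pm = ≋-trans (coeffwise {p = f} {q = ι β} f≈ιβ) (≋-trans (ι-cong β≋pm) (≡⇒≋ (ι-pm σ τ)))

InCF-ι⁻-pm : ∀ (C : Code (suc n)) f → Disjoint σ τ → f ≋ pm σ τ → MinimalIn (NeuralIdeal C) σ τ →
             fromℕ n ∉ σ → fromℕ n ∉ τ → Σ (Poly n) λ β → InCF (NeuralIdeal (deleteLast C)) β × f ≈ ι β
InCF-ι⁻-pm C f σ#τ f≋pm minimal ℓ∉σ ℓ∉τ with ∉fromℕ⇒∷ʳ ℓ∉σ | ∉fromℕ⇒∷ʳ ℓ∉τ
... | σ₀ , refl | τ₀ , refl =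
  pm σ₀ τ₀ ,
  Equivalence.from (InCF⇔ (deleteLast C) (pm σ₀ τ₀)) (σ₀ , τ₀ , σ₀#τ₀ , ≋-refl , MinimalIn-∷ʳ⁻ C σ₀#τ₀ minimal) ,
  coeff-≡ (≋-trans f≋pm (≡⇒≋ (sym (ι-pm σ₀ τ₀))))
  where σ₀#τ₀ = Disjoint-∷ʳ⁻ σ#τ

InCF-ι⁻ : ∀ (C : Code (suc n)) f → InCF (NeuralIdeal C) f → ¬ (var (fromℕ n) ∣ f) → ¬ (oneMinus (fromℕ n) ∣ f) →
          Σ (Poly n) λ β → InCF (NeuralIdeal (deleteLast C)) β × f ≈ ι β
InCF-ι⁻ C f f∈CF ¬x∣f ¬1-x∣f with Equivalence.to (InCF⇔ C f) f∈CF
... | σ , τ , σ#τ , f≋pm , minimal = InCF-ι⁻-pm C f σ#τ f≋pm minimal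
  (¬x∣f ∘ ∣-respʳ-≋ (≋-sym f≋pm) ∘ Equivalence.from (var∣pm⇔∈ σ#τ))
  (¬1-x∣f ∘ ∣-respʳ-≋ (≋-sym f≋pm) ∘ Equivalence.from (oneMinus∣pm⇔∈ σ#τ))

mainTheorem12 : (m : ℕ) (C : Code (suc m)) (f : Poly (suc m)) →
    ((Σ (Poly m) λ β → InCF (NeuralIdeal (deleteLast C)) β × f ≈ ι β) →
      (InCF (NeuralIdeal C) f × ¬ (var (fromℕ m) ∣ f) × ¬ (oneMinus (fromℕ m) ∣ f)))
    × ((InCF (NeuralIdeal C) f × ¬ (var (fromℕ m) ∣ f) × ¬ (oneMinus (fromℕ m) ∣ f)) →
      (Σ (Poly m) λ β → InCF (NeuralIdeal (deleteLast C)) β × f ≈ ι β))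
mainTheorem12 m C f =
  (λ (β , β∈CF , f≈ιβ) → InCF-ι⁺ C β f β∈CF f≈ιβ) ,
  (λ (f∈CF , ¬x∣f , ¬1-x∣f) → InCF-ι⁻ C f f∈CF ¬x∣f ¬1-x∣f)
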